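{- Let $a$ and $m$ be positive integers with $a+1\leq m\leq 2a+1$, and let $R_2(m,a)$ denote the 2-color Rado number of $x_1+x_2+\cdots+x_{m-1}=ax_m$. Then $R_2(m,a)=1$ if and only if $m=a+1$. If $a+2\leq m\leq 2a+1$, then $R_2(m,a)\in\{3,4,5\}$, and: $R_2(m,a)=3$ iff $m\leq \frac{3a}{2}+1$ and $a\equiv m-1 \pmod 2$; $R_2(m,a)=4$ iff either (i) $m\leq\frac{3a}{2}+1$ and $a\not\equiv m-1\pmod 2$, or (ii) $m>\frac{3a}{2}+1$ and $a\equiv m-1\pmod 3$; $R_2(m,a)=5$ iff $m>\frac{3a}{2}+1$ and $a\not\equiv m-1\pmod 3$.
   Context: The 2-color Rado number $R_2(m,a)$ of $x_1+\cdots+x_{m-1}=ax_m$ is the least positive integer $n$ such that for every coloring of $[n]=\{1,\dots,n\}$ with two colors there exist $x_1,\dots,x_m\in[n]$ (not necessarily distinct), all of the same color, satisfying the equation. -}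

module Defs where

open import Data.Nat using (ℕ; zero; suc; _+_; _*_; _∸_; _≤_; _<_)
open import Data.Bool using (Bool)
open import Data.Fin using (Fin)
open import Data.Product using (Σ; _×_; ∃)
open import Relation.Binary.PropositionalEquality using (_≡_)
open import Relation.Nullary using (¬_)

sumFin : {k : ℕ} → (Fin k → ℕ) → ℕ
sumFin {zero}  f = 0
sumFin {suc k} f = f Fin.zero + sumFin {k} (λ i → f (Fin.suc i))

InRange : ℕ → ℕ → Set
InRange n x = 1 ≤ x × x ≤ n

-- A 2-colouring of [n] is given by χ : ℕ → Bool (values outside [n] are irrelevant).
-- χ admits a monochromatic solution in [n] of x₁+⋯+x_{m-1} = a·x_m
MonoSol : (m a n : ℕ) → (ℕ → Bool) → Set
MonoSol m a n χ =
  Σ Bool λ col →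
  Σ (Fin (m ∸ 1) → ℕ) λ xs →
  Σ ℕ λ xm →
    ((i : Fin (m ∸ 1)) → InRange n (xs i) × χ (xs i) ≡ col)
    × InRange n xm × χ xm ≡ col
    × sumFin xs ≡ a * xm

RadoProperty : (m a n : ℕ) → Set
RadoProperty m a n = (χ : ℕ → Bool) → MonoSol m a n χ

IsRadoNumber : (m a R : ℕ) → Set
IsRadoNumber m a R =
  1 ≤ R × RadoProperty m a R × ((k : ℕ) → 1 ≤ k → k < R → ¬ RadoProperty m a k)

module Submission where

-- Write m = k + 1 with k = 2e + f and a = e + f; the hypothesis a + 1 ≤ m ≤ 2a + 1
-- says exactly that e, f ≥ 0.  In these terms m = a + 1 is e = 0, the condition
-- m ≤ 3a/2 + 1 is e ≤ f, and a ≡ m − 1 modulo d (d = 2, 3) is d ∣ e.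
--
-- Upper bounds come from explicit monochromatic solutions.  The basic one takes
-- e copies each of x and y and f copies of x + y, with xm = x + y; together with
-- three two-valued solutions (ones and threes for 2 ∣ e, twos and threes for
-- e ≤ f, ones and fours for 3 ∣ e) a short case split on the colours of 1, …, 5
-- shows that [3], [4] or [5] has the Rado property in the respective cases.
-- Lower bounds come from colourings of [R − 1] each of whose colour classes is
-- either confined to an interval [l, u] with a·u < k·l, or consists of numbers
-- ≡ 1 modulo d while a ≢ k modulo d; neither kind of class contains a solution.

open import Defs
open import Data.Nat using (ℕ; zero; suc; _+_; _*_; _∸_; _≤_; _<_; _%_; _/_; z≤n; s≤s; _≤?_; NonZero)
open import Data.Nat.Properties
open import Data.Nat.DivMod using (m≡m%n+[m/n]*n; [m+kn]%n≡m%n; %-distribˡ-+; %-distribˡ-*)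
open import Data.Nat.Divisibility using (_∣_; divides; _∣?_; _∣0; ∣m+n∣m⇒∣n; n∣m*n)
open import Data.Nat.Tactic.RingSolver using (solve-∀)
open import Data.Bool using (Bool; true; false)
open import Data.Bool.Properties using () renaming (_≟_ to _≟ᵇ_)
open import Data.Fin using (Fin)
open import Data.Vec using (Vec; []; _∷_; _++_; replicate; lookup; sum)
open import Data.Vec.Properties using (sum-++)
open import Data.Vec.Relation.Unary.All using (All; []; _∷_)
open import Data.Vec.Relation.Unary.All.Properties using (lookup⁺; ++⁺)
open import Data.Product using (Σ; _×_; _,_; proj₁; proj₂)
open import Data.Sum using (_⊎_; inj₁; inj₂; [_,_]′)
open import Data.Empty using (⊥-elim)
open import Function using (_∘_)
open import Function.Bundles using (_⇔_; mk⇔; Equivalence)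
open import Relation.Nullary using (¬_; yes; no)
open import Relation.Nullary.Decidable using (True; toWitness)
open import Relation.Binary.PropositionalEquality
open Equivalence using (to; from)

Coloured : ℕ → (ℕ → Bool) → Bool → ℕ → Set
Coloured n χ col x = InRange n x × χ x ≡ col

-- A monochromatic solution of colour col with k summands.  A solution in the
-- sense of MonoSol (suc k) a n χ is a colour together with one of these.
record MonoSolOf (k a n : ℕ) (χ : ℕ → Bool) (col : Bool) : Set where
  constructor monoSol
  field
    summands   : Fin k → ℕ
    xm         : ℕ
    summandsOk : ∀ i → Coloured n χ col (summands i)
    xmOk       : Coloured n χ col xm
    equation   : sumFin summands ≡ a * xm

ClassWithin : ℕ → (ℕ → Bool) → Bool → (ℕ → Set) → Set
ClassWithin n χ col P = ∀ x → Coloured n χ col x → P x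

within : ∀ {n} x → {True (1 ≤? x)} → {True (x ≤? n)} → InRange n x
within x {p} {q} = toWitness p , toWitness q

radoMono : ∀ {m a n n′} → n ≤ n′ → RadoProperty m a n → RadoProperty m a n′
radoMono n≤n′ rado χ with rado χ
... | col , xs , xm , xsOk , (1≤xm , xm≤n) , χxm , eq =
  col , xs , xm , (λ i → widen (xsOk i)) , (1≤xm , ≤-trans xm≤n n≤n′) , χxm , eq
  where
  widen : ∀ {x col} → Coloured _ χ col x → Coloured _ χ col x
  widen ((1≤x , x≤n) , χx) = (1≤x , ≤-trans x≤n n≤n′) , χx

noRado0 : ∀ m a → ¬ RadoProperty m a 0
noRado0 m a rado with rado (λ _ → true)
... | _ , _ , _ , _ , (1≤xm , xm≤0) , _ = <⇒≱ 1≤xm xm≤0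

radoNumber : ∀ {m a r} → RadoProperty m a (suc r) → ¬ RadoProperty m a r → IsRadoNumber m a (suc r)
radoNumber {m} {a} upper lower =
  s≤s z≤n , upper , λ k _ k<R radoK → lower (radoMono {m} {a} (≤-pred k<R) radoK)

noMonoSol : ∀ {k a n} (χ : ℕ → Bool) → (∀ col → ¬ MonoSolOf k a n χ col) → ¬ RadoProperty (suc k) a n
noMonoSol χ classFree rado with rado χ
... | col , xs , xm , xsOk , xmR , χxm , eq = classFree col (monoSol xs xm xsOk (xmR , χxm) eq)

-- Solutions are written as vectors of summands: c₁ copies of v₁ followed by
-- c₂ copies of v₂, and so on; the next three facts are the bookkeeping for this.

sumFin-lookup : ∀ {k} (xs : Vec ℕ k) → sumFin (lookup xs) ≡ sum xs
sumFin-lookup []       = refl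
sumFin-lookup (x ∷ xs) = cong (x +_) (sumFin-lookup xs)

sum-replicate : ∀ c v → sum (replicate c v) ≡ c * v
sum-replicate zero    v = refl
sum-replicate (suc c) v = cong (v +_) (sum-replicate c v)

replicate⁺ : ∀ {P : ℕ → Set} c {v} → P v → All P (replicate c v)
replicate⁺ zero    pv = []
replicate⁺ (suc c) pv = pv ∷ replicate⁺ c pv

vecSolution : ∀ {k a n χ} (xs : Vec ℕ k) xm →
  All (Coloured n χ (χ xm)) xs → InRange n xm → sum xs ≡ a * xm → MonoSol (suc k) a n χ
vecSolution {χ = χ} xs xm xsOk xmOk eq =
  χ xm , lookup xs , xm , lookup⁺ xsOk , xmOk , refl , trans (sumFin-lookup xs) eq

twoValueSolution : ∀ {k n χ} a c d x y → c + d ≡ k → c * x + d * y ≡ a * y →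
  InRange n x → InRange n y → χ x ≡ χ y → MonoSol (suc k) a n χ
twoValueSolution a c d x y refl eq xOk yOk χx =
  vecSolution {a = a} (replicate c x ++ replicate d y) y
    (++⁺ (replicate⁺ c (xOk , χx)) (replicate⁺ d (yOk , refl))) yOk
    (begin
      sum (replicate c x ++ replicate d y)      ≡⟨ sum-++ (replicate c x) ⟩
      sum (replicate c x) + sum (replicate d y) ≡⟨ cong₂ _+_ (sum-replicate c x) (sum-replicate d y) ⟩
      c * x + d * y                             ≡⟨ eq ⟩
      a * y ∎)
  where open ≡-Reasoning

-- For k = 2e + f and a = e + f: e copies each of x and y and f copies of
-- x + y sum to (e + f)(x + y), so xm = x + y gives a solution.
pairSumSolution : ∀ {n χ} e f x y → InRange n x → InRange n y → InRange n (x + y) →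
  χ x ≡ χ (x + y) → χ y ≡ χ (x + y) → MonoSol (suc (e + f + e)) (e + f) n χ
pairSumSolution e f x y xOk yOk sOk χx χy =
  vecSolution {a = e + f} ((replicate e x ++ replicate f (x + y)) ++ replicate e y) (x + y)
    (++⁺ (++⁺ (replicate⁺ e (xOk , χx)) (replicate⁺ f (sOk , refl))) (replicate⁺ e (yOk , χy))) sOk
    (begin
      sum ((replicate e x ++ replicate f (x + y)) ++ replicate e y)
        ≡⟨ sum-++ (replicate e x ++ replicate f (x + y)) ⟩
      sum (replicate e x ++ replicate f (x + y)) + sum (replicate e y)
        ≡⟨ cong (_+ sum (replicate e y)) (sum-++ (replicate e x)) ⟩
      sum (replicate e x) + sum (replicate f (x + y)) + sum (replicate e y)
        ≡⟨ cong₂ _+_ (cong₂ _+_ (sum-replicate e x) (sum-replicate f (x + y))) (sum-replicate e y) ⟩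
      e * x + f * (x + y) + e * y
        ≡⟨ regroup e f x y ⟩
      (e + f) * (x + y) ∎)
  where
  open ≡-Reasoning
  regroup : ∀ e f x y → e * x + f * (x + y) + e * y ≡ (e + f) * (x + y)
  regroup = solve-∀

otherColour : ∀ {x y : Bool} z → x ≢ y → z ≡ x ⊎ z ≡ y
otherColour {false} {false} _     x≢y = ⊥-elim (x≢y refl)
otherColour {true}  {true}  _     x≢y = ⊥-elim (x≢y refl)
otherColour {false} {true}  false _   = inj₁ refl
otherColour {false} {true}  true  _   = inj₂ refl
otherColour {true}  {false} false _   = inj₂ refl
otherColour {true}  {false} true  _   = inj₁ refl

allOnes : ∀ {k a} → k ≡ a → RadoProperty (suc k) a 1
allOnes {k} {a} k≡a χ = twoValueSolution a 0 k 1 1 refl (cong (_* 1) k≡a) (within 1) (within 1) refl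

onesAndThrees : ∀ {n χ} t f → InRange n 1 → InRange n 3 → χ 1 ≡ χ 3 →
  MonoSol (suc (t * 2 + f + t * 2)) (t * 2 + f) n χ
onesAndThrees t f = twoValueSolution (t * 2 + f) (t * 3) (t + f) 1 3 (count t f) (total t f)
  where
  count : ∀ t f → t * 3 + (t + f) ≡ t * 2 + f + t * 2
  count = solve-∀
  total : ∀ t f → t * 3 * 1 + (t + f) * 3 ≡ (t * 2 + f) * 3
  total = solve-∀

onesAndFours : ∀ {n χ} t f → InRange n 1 → InRange n 4 → χ 1 ≡ χ 4 →
  MonoSol (suc (t * 3 + f + t * 3)) (t * 3 + f) n χ
onesAndFours t f = twoValueSolution (t * 3 + f) (t * 4) (t * 2 + f) 1 4 (count t f) (total t f)
  where
  count : ∀ t f → t * 4 + (t * 2 + f) ≡ t * 3 + f + t * 3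
  count = solve-∀
  total : ∀ t f → t * 4 * 1 + (t * 2 + f) * 4 ≡ (t * 3 + f) * 4
  total = solve-∀

twosAndThrees : ∀ {n χ} e f → e ≤ f → InRange n 2 → InRange n 3 → χ 2 ≡ χ 3 →
  MonoSol (suc (e + f + e)) (e + f) n χ
twosAndThrees e f e≤f with m≤n⇒∃[o]m+o≡n e≤f
... | d , refl = twoValueSolution (e + (e + d)) (e * 3) d 2 3 (count e d) (total e d)
  where
  count : ∀ e d → e * 3 + d ≡ e + (e + d) + e
  count = solve-∀
  total : ∀ e d → e * 3 * 2 + d * 3 ≡ (e + (e + d)) * 3
  total = solve-∀

rado3 : ∀ {e f} → 2 ∣ e → e ≤ f → RadoProperty (suc (e + f + e)) (e + f) 3
rado3 {e} {f} (divides t refl) e≤f χ with χ 1 ≟ᵇ χ 2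
... | yes χ1≡χ2 = pairSumSolution e f 1 1 (within 1) (within 1) (within 2) χ1≡χ2 χ1≡χ2
... | no χ1≢χ2 with otherColour (χ 3) χ1≢χ2
...   | inj₁ χ3≡χ1 = onesAndThrees t f (within 1) (within 3) (sym χ3≡χ1)
...   | inj₂ χ3≡χ2 = twosAndThrees e f e≤f (within 2) (within 3) (sym χ3≡χ2)

rado4-balanced : ∀ {e f} → e ≤ f → RadoProperty (suc (e + f + e)) (e + f) 4
rado4-balanced {e} {f} e≤f χ with χ 1 ≟ᵇ χ 2
... | yes χ1≡χ2 = pairSumSolution e f 1 1 (within 1) (within 1) (within 2) χ1≡χ2 χ1≡χ2
... | no χ1≢χ2 with otherColour (χ 4) χ1≢χ2
...   | inj₂ χ4≡χ2 = pairSumSolution e f 2 2 (within 2) (within 2) (within 4) (sym χ4≡χ2) (sym χ4≡χ2)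
...   | inj₁ χ4≡χ1 with otherColour (χ 3) χ1≢χ2
...     | inj₁ χ3≡χ1 = pairSumSolution e f 1 3 (within 1) (within 3) (within 4)
                         (sym χ4≡χ1) (trans χ3≡χ1 (sym χ4≡χ1))
...     | inj₂ χ3≡χ2 = twosAndThrees e f e≤f (within 2) (within 3) (sym χ3≡χ2)

rado4-divisible : ∀ {e f} → 3 ∣ e → RadoProperty (suc (e + f + e)) (e + f) 4
rado4-divisible {e} {f} (divides t refl) χ with χ 1 ≟ᵇ χ 2
... | yes χ1≡χ2 = pairSumSolution e f 1 1 (within 1) (within 1) (within 2) χ1≡χ2 χ1≡χ2
... | no χ1≢χ2 with otherColour (χ 4) χ1≢χ2
...   | inj₂ χ4≡χ2 = pairSumSolution e f 2 2 (within 2) (within 2) (within 4) (sym χ4≡χ2) (sym χ4≡χ2)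
...   | inj₁ χ4≡χ1 = onesAndFours t f (within 1) (within 4) (sym χ4≡χ1)

rado5 : ∀ e f → RadoProperty (suc (e + f + e)) (e + f) 5
rado5 e f χ with χ 1 ≟ᵇ χ 2
... | yes χ1≡χ2 = pairSumSolution e f 1 1 (within 1) (within 1) (within 2) χ1≡χ2 χ1≡χ2
... | no χ1≢χ2 with otherColour (χ 4) χ1≢χ2
...   | inj₂ χ4≡χ2 = pairSumSolution e f 2 2 (within 2) (within 2) (within 4) (sym χ4≡χ2) (sym χ4≡χ2)
...   | inj₁ χ4≡χ1 with otherColour (χ 3) χ1≢χ2
...     | inj₁ χ3≡χ1 = pairSumSolution e f 1 3 (within 1) (within 3) (within 4)
                         (sym χ4≡χ1) (trans χ3≡χ1 (sym χ4≡χ1))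
...     | inj₂ χ3≡χ2 with otherColour (χ 5) χ1≢χ2
...       | inj₂ χ5≡χ2 = pairSumSolution e f 2 3 (within 2) (within 3) (within 5)
                           (sym χ5≡χ2) (trans χ3≡χ2 (sym χ5≡χ2))
...       | inj₁ χ5≡χ1 = pairSumSolution e f 1 4 (within 1) (within 4) (within 5)
                           (sym χ5≡χ1) (trans χ4≡χ1 (sym χ5≡χ1))

shiftedComparison : ∀ {p q e f} X → p ≡ X + f → q ≡ X + e → (p < q ⇔ f < e)
shiftedComparison {e = e} {f} X refl refl = mk⇔ (+-cancelˡ-< X f e) (+-monoʳ-< X)

threeHalves : ∀ e f → (e + f) * 3 < (e + f + e) * 2 ⇔ f < e
threeHalves e f = shiftedComparison (e * 3 + f * 2) (lhs e f) (rhs e f)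
  where
  lhs : ∀ e f → (e + f) * 3 ≡ e * 3 + f * 2 + f
  lhs = solve-∀
  rhs : ∀ e f → (e + f + e) * 2 ≡ e * 3 + f * 2 + e
  rhs = solve-∀

unbalanced⇔ : ∀ e f → 3 * (e + f) + 2 < 2 * suc (e + f + e) ⇔ f < e
unbalanced⇔ e f = shiftedComparison (e * 3 + f * 2 + 2) (lhs e f) (rhs e f)
  where
  lhs : ∀ e f → 3 * (e + f) + 2 ≡ e * 3 + f * 2 + 2 + f
  lhs = solve-∀
  rhs : ∀ e f → 2 * suc (e + f + e) ≡ e * 3 + f * 2 + 2 + e
  rhs = solve-∀

balanced⇔ : ∀ e f → 2 * suc (e + f + e) ≤ 3 * (e + f) + 2 ⇔ e ≤ f
balanced⇔ e f = mk⇔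
  (λ le → ≮⇒≥ (λ f<e → ≤⇒≯ le (from (unbalanced⇔ e f) f<e)))
  (λ e≤f → ≮⇒≥ (λ gt → ≤⇒≯ e≤f (to (unbalanced⇔ e f) gt)))

residue⇔ : ∀ a e d .{{_ : NonZero d}} → a % d ≡ (a + e) % d ⇔ d ∣ e
residue⇔ a e d = mk⇔ divides-e (λ { (divides q refl) → sym ([m+kn]%n≡m%n a q d) })
  where
  open ≡-Reasoning
  divides-e : a % d ≡ (a + e) % d → d ∣ e
  divides-e same = ∣m+n∣m⇒∣n (divides ((a + e) / d) quotients) (n∣m*n (a / d))
    where
    quotients : a / d * d + e ≡ (a + e) / d * d
    quotients = +-cancelˡ-≡ (a % d) _ _ (begin
      a % d + (a / d * d + e)       ≡⟨ +-assoc (a % d) _ e ⟨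
      a % d + a / d * d + e         ≡⟨ cong (_+ e) (m≡m%n+[m/n]*n a d) ⟨
      a + e                         ≡⟨ m≡m%n+[m/n]*n (a + e) d ⟩
      (a + e) % d + (a + e) / d * d ≡⟨ cong (_+ (a + e) / d * d) same ⟨
      a % d + (a + e) / d * d       ∎)

Between : ℕ → ℕ → ℕ → Set
Between l u x = l ≤ x × x ≤ u

sumLowerBound : ∀ {k} l (xs : Fin k → ℕ) → (∀ i → l ≤ xs i) → k * l ≤ sumFin xs
sumLowerBound {zero}  l xs bound = z≤n
sumLowerBound {suc k} l xs bound =
  +-mono-≤ (bound Fin.zero) (sumLowerBound l (xs ∘ Fin.suc) (bound ∘ Fin.suc))

intervalBound : ∀ {k a l u} (xs : Fin k → ℕ) xm →
  (∀ i → l ≤ xs i) → xm ≤ u → sumFin xs ≡ a * xm → k * l ≤ a * u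
intervalBound {k} {a} {l} {u} xs xm low xm≤u eq = begin
  k * l     ≤⟨ sumLowerBound l xs low ⟩
  sumFin xs ≡⟨ eq ⟩
  a * xm    ≤⟨ *-monoʳ-≤ a xm≤u ⟩
  a * u     ∎
  where open ≤-Reasoning

module _ (d : ℕ) .{{_ : NonZero d}} where
  open ≡-Reasoning

  sumResidue : ∀ {k} (xs : Fin k → ℕ) → (∀ i → xs i % d ≡ 1 % d) → sumFin xs % d ≡ k % d
  sumResidue {zero}  xs ones = refl
  sumResidue {suc k} xs ones = begin
    (xs Fin.zero + sumFin (xs ∘ Fin.suc)) % d             ≡⟨ %-distribˡ-+ (xs Fin.zero) _ d ⟩
    (xs Fin.zero % d + sumFin (xs ∘ Fin.suc) % d) % d     ≡⟨ cong₂ (λ u v → (u + v) % d) (ones Fin.zero)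
                                                                   (sumResidue (xs ∘ Fin.suc) (ones ∘ Fin.suc)) ⟩
    (1 % d + k % d) % d                                   ≡⟨ %-distribˡ-+ 1 k d ⟨
    suc k % d                                             ∎

  productResidue : ∀ a xm → xm % d ≡ 1 % d → (a * xm) % d ≡ a % d
  productResidue a xm one = begin
    (a * xm) % d              ≡⟨ %-distribˡ-* a xm d ⟩
    (a % d * (xm % d)) % d    ≡⟨ cong (λ v → (a % d * v) % d) one ⟩
    (a % d * (1 % d)) % d     ≡⟨ %-distribˡ-* a 1 d ⟨
    (a * 1) % d               ≡⟨ cong (_% d) (*-identityʳ a) ⟩
    a % d                     ∎

  residueBound : ∀ {k a} (xs : Fin k → ℕ) xm →
    (∀ i → xs i % d ≡ 1 % d) → xm % d ≡ 1 % d → sumFin xs ≡ a * xm → a % d ≡ k % d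
  residueBound {k} {a} xs xm ones one eq = begin
    a % d          ≡⟨ productResidue a xm one ⟨
    (a * xm) % d   ≡⟨ cong (_% d) eq ⟨
    sumFin xs % d  ≡⟨ sumResidue xs ones ⟩
    k % d          ∎

intervalObstruction : ∀ {k a n χ col l u} → a * u < k * l →
  ClassWithin n χ col (Between l u) → ¬ MonoSolOf k a n χ col
intervalObstruction {a = a} au<kl inside (monoSol xs xm xsOk xmOk eq) =
  <⇒≱ au<kl (intervalBound {a = a} xs xm (λ i → proj₁ (inside (xs i) (xsOk i))) (proj₂ (inside xm xmOk)) eq)

residueObstruction : ∀ {k a n χ col} d .{{_ : NonZero d}} → a % d ≢ k % d →
  ClassWithin n χ col (λ x → x % d ≡ 1 % d) → ¬ MonoSolOf k a n χ col
residueObstruction d a≢k inside (monoSol xs xm xsOk xmOk eq) =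
  a≢k (residueBound d xs xm (λ i → inside (xs i) (xsOk i)) (inside xm xmOk) eq)

isolateOne : ℕ → Bool
isolateOne 1 = true
isolateOne _ = false

isolateOne-true : ∀ {n} → ClassWithin n isolateOne true (Between 1 1)
isolateOne-true 1             _       = ≤-refl , ≤-refl
isolateOne-true 0             (_ , ())
isolateOne-true (suc (suc x)) (_ , ())

isolateOne-false : ∀ {n} → ClassWithin n isolateOne false (Between 2 n)
isolateOne-false 0             ((() , _) , _)
isolateOne-false 1             (_ , ())
isolateOne-false (suc (suc x)) ((_ , x≤n) , _) = s≤s (s≤s z≤n) , x≤n

isolateTwo : ℕ → Bool
isolateTwo 2 = false
isolateTwo _ = true

isolateTwo-false : ∀ {n} → ClassWithin n isolateTwo false (Between 2 2)
isolateTwo-false 2                   _        = ≤-refl , ≤-refl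
isolateTwo-false 0                   (_ , ())
isolateTwo-false 1                   (_ , ())
isolateTwo-false (suc (suc (suc x))) (_ , ())

isolateTwo-true : ClassWithin 3 isolateTwo true (λ x → x % 2 ≡ 1 % 2)
isolateTwo-true 1 _ = refl
isolateTwo-true 3 _ = refl
isolateTwo-true 0                         ((() , _) , _)
isolateTwo-true 2                         (_ , ())
isolateTwo-true (suc (suc (suc (suc x)))) ((_ , s≤s (s≤s (s≤s ()))) , _)

middlePair : ℕ → Bool
middlePair 2 = false
middlePair 3 = false
middlePair _ = true

middlePair-false : ∀ {n} → ClassWithin n middlePair false (Between 2 3)
middlePair-false 2                         _        = s≤s (s≤s z≤n) , s≤s (s≤s z≤n)
middlePair-false 3                         _        = s≤s (s≤s z≤n) , ≤-refl
middlePair-false 0                         (_ , ())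
middlePair-false 1                         (_ , ())
middlePair-false (suc (suc (suc (suc x)))) (_ , ())

middlePair-true : ClassWithin 4 middlePair true (λ x → x % 3 ≡ 1 % 3)
middlePair-true 1 _ = refl
middlePair-true 4 _ = refl
middlePair-true 0                               ((() , _) , _)
middlePair-true 2                               (_ , ())
middlePair-true 3                               (_ , ())
middlePair-true (suc (suc (suc (suc (suc x))))) ((_ , s≤s (s≤s (s≤s (s≤s ())))) , _)

-- For e ≥ 1 there are more summands than the coefficient a, so a singleton
-- colour class {v} never carries a solution (a·v < k·v).
noRado2 : ∀ {e f} → 1 ≤ e → ¬ RadoProperty (suc (e + f + e)) (e + f) 2
noRado2 {e} {f} 1≤e = noMonoSol {a = e + f} isolateOne λ
  { true  → intervalObstruction (*-monoˡ-< 1 a<k) isolateOne-true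
  ; false → intervalObstruction (*-monoˡ-< 2 a<k) isolateOne-false }
  where
  a<k : e + f < e + f + e
  a<k = m<m+n (e + f) 1≤e

noRado3-odd : ∀ {e f} → ¬ 2 ∣ e → ¬ RadoProperty (suc (e + f + e)) (e + f) 3
noRado3-odd {e} {f} 2∤e = noMonoSol {a = e + f} isolateTwo λ
  { true  → residueObstruction 2 (2∤e ∘ to (residue⇔ (e + f) e 2)) isolateTwo-true
  ; false → intervalObstruction (*-monoˡ-< 2 (m<m+n (e + f) 1≤e)) isolateTwo-false }
  where
  1≤e : 1 ≤ e
  1≤e = n≢0⇒n>0 (λ e≡0 → 2∤e (subst (2 ∣_) (sym e≡0) (2 ∣0)))

-- e > f: within [3], {1} against {2, 3}; the latter is too narrow since 3a < 2k
noRado3-unbalanced : ∀ {e f} → f < e → ¬ RadoProperty (suc (e + f + e)) (e + f) 3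
noRado3-unbalanced {e} {f} f<e = noMonoSol {a = e + f} isolateOne λ
  { true  → intervalObstruction (*-monoˡ-< 1 (m<m+n (e + f) (≤-<-trans z≤n f<e))) isolateOne-true
  ; false → intervalObstruction (from (threeHalves e f) f<e) isolateOne-false }

noRado4 : ∀ {e f} → f < e → ¬ 3 ∣ e → ¬ RadoProperty (suc (e + f + e)) (e + f) 4
noRado4 {e} {f} f<e 3∤e = noMonoSol {a = e + f} middlePair λ
  { true  → residueObstruction 3 (3∤e ∘ to (residue⇔ (e + f) e 3)) middlePair-true
  ; false → intervalObstruction (from (threeHalves e f) f<e) middlePair-false }

Classification : ℕ → ℕ → ℕ → Set
Classification m a R =
  (R ≡ 1 ⇔ m ≡ a + 1)
  × (a + 2 ≤ m →
      (R ≡ 3 ⊎ R ≡ 4 ⊎ R ≡ 5)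
      × (R ≡ 3 ⇔ (2 * m ≤ 3 * a + 2 × a % 2 ≡ (m ∸ 1) % 2))
      × (R ≡ 4 ⇔ ((2 * m ≤ 3 * a + 2 × a % 2 ≢ (m ∸ 1) % 2)
                   ⊎ (3 * a + 2 < 2 * m × a % 3 ≡ (m ∸ 1) % 3)))
      × (R ≡ 5 ⇔ (3 * a + 2 < 2 * m × a % 3 ≢ (m ∸ 1) % 3)))

Answer : ℕ → ℕ → ℕ → Set
Answer m a R = IsRadoNumber m a R × Classification m a R

holds : ∀ {r : ℕ} {C : Set} → C → (r ≡ r ⇔ C)
holds c = mk⇔ (λ _ → c) (λ _ → refl)

fails : ∀ {r s : ℕ} {C : Set} → r ≢ s → ¬ C → (r ≡ s ⇔ C)
fails r≢s ¬c = mk⇔ (⊥-elim ∘ r≢s) (⊥-elim ∘ ¬c)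

answer1 : ∀ f → Answer (suc (0 + f + 0)) (0 + f) 1
answer1 f =
  radoNumber {suc (0 + f + 0)} {0 + f} (allOnes (+-identityʳ f)) (noRado0 (suc (0 + f + 0)) (0 + f)) ,
  holds (m≡a+1 f) ,
  λ a+2≤m → ⊥-elim (<-irrefl refl (+-cancelˡ-≤ f 2 1 (subst (f + 2 ≤_) (m≡a+1 f) a+2≤m)))
  where
  m≡a+1 : ∀ f → suc (f + 0) ≡ f + 1
  m≡a+1 = solve-∀

notMinimal : ∀ {e f} → 1 ≤ e → suc (e + f + e) ≢ e + f + 1
notMinimal {e} {f} 1≤e m≡a+1 = <-irrefl (sym m≡a+1) (s≤s (+-monoʳ-≤ (e + f) 1≤e))

answer3 : ∀ {e f} → 1 ≤ e → e ≤ f → 2 ∣ e → Answer (suc (e + f + e)) (e + f) 3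
answer3 {e} {f} 1≤e e≤f 2∣e =
  radoNumber {suc (e + f + e)} {e + f} (rado3 2∣e e≤f) (noRado2 1≤e) ,
  fails (λ ()) (notMinimal 1≤e) ,
  λ _ → inj₁ refl ,
        holds (balanced , even) ,
        fails (λ ()) [ (λ c → proj₂ c even) , notUnbalanced ∘ proj₁ ]′ ,
        fails (λ ()) (notUnbalanced ∘ proj₁)
  where
  balanced : 2 * suc (e + f + e) ≤ 3 * (e + f) + 2
  balanced = from (balanced⇔ e f) e≤f
  notUnbalanced : ¬ (3 * (e + f) + 2 < 2 * suc (e + f + e))
  notUnbalanced = ≤⇒≯ e≤f ∘ to (unbalanced⇔ e f)
  even : (e + f) % 2 ≡ (e + f + e) % 2
  even = from (residue⇔ (e + f) e 2) 2∣e

answer4-balanced : ∀ {e f} → 1 ≤ e → e ≤ f → ¬ 2 ∣ e → Answer (suc (e + f + e)) (e + f) 4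
answer4-balanced {e} {f} 1≤e e≤f 2∤e =
  radoNumber {suc (e + f + e)} {e + f} (rado4-balanced e≤f) (noRado3-odd 2∤e) ,
  fails (λ ()) (notMinimal 1≤e) ,
  λ _ → inj₂ (inj₁ refl) ,
        fails (λ ()) (odd ∘ proj₂) ,
        holds (inj₁ (balanced , odd)) ,
        fails (λ ()) (notUnbalanced ∘ proj₁)
  where
  balanced : 2 * suc (e + f + e) ≤ 3 * (e + f) + 2
  balanced = from (balanced⇔ e f) e≤f
  notUnbalanced : ¬ (3 * (e + f) + 2 < 2 * suc (e + f + e))
  notUnbalanced = ≤⇒≯ e≤f ∘ to (unbalanced⇔ e f)
  odd : (e + f) % 2 ≢ (e + f + e) % 2
  odd = 2∤e ∘ to (residue⇔ (e + f) e 2)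

answer4-unbalanced : ∀ {e f} → 1 ≤ e → f < e → 3 ∣ e → Answer (suc (e + f + e)) (e + f) 4
answer4-unbalanced {e} {f} 1≤e f<e 3∣e =
  radoNumber {suc (e + f + e)} {e + f} (rado4-divisible 3∣e) (noRado3-unbalanced f<e) ,
  fails (λ ()) (notMinimal 1≤e) ,
  λ _ → inj₂ (inj₁ refl) ,
        fails (λ ()) (notBalanced ∘ proj₁) ,
        holds (inj₂ (unbalanced , divisible)) ,
        fails (λ ()) (λ c → proj₂ c divisible)
  where
  unbalanced : 3 * (e + f) + 2 < 2 * suc (e + f + e)
  unbalanced = from (unbalanced⇔ e f) f<e
  notBalanced : ¬ (2 * suc (e + f + e) ≤ 3 * (e + f) + 2)
  notBalanced = <⇒≱ f<e ∘ to (balanced⇔ e f)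
  divisible : (e + f) % 3 ≡ (e + f + e) % 3
  divisible = from (residue⇔ (e + f) e 3) 3∣e

answer5 : ∀ {e f} → 1 ≤ e → f < e → ¬ 3 ∣ e → Answer (suc (e + f + e)) (e + f) 5
answer5 {e} {f} 1≤e f<e 3∤e =
  radoNumber {suc (e + f + e)} {e + f} (rado5 e f) (noRado4 f<e 3∤e) ,
  fails (λ ()) (notMinimal 1≤e) ,
  λ _ → inj₂ (inj₂ refl) ,
        fails (λ ()) (notBalanced ∘ proj₁) ,
        fails (λ ()) [ notBalanced ∘ proj₁ , indivisible ∘ proj₂ ]′ ,
        holds (unbalanced , indivisible)
  where
  unbalanced : 3 * (e + f) + 2 < 2 * suc (e + f + e)
  unbalanced = from (unbalanced⇔ e f) f<e
  notBalanced : ¬ (2 * suc (e + f + e) ≤ 3 * (e + f) + 2)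
  notBalanced = <⇒≱ f<e ∘ to (balanced⇔ e f)
  indivisible : (e + f) % 3 ≢ (e + f + e) % 3
  indivisible = 3∤e ∘ to (residue⇔ (e + f) e 3)

radoNumberOf : ∀ e f → Σ ℕ (Answer (suc (e + f + e)) (e + f))
radoNumberOf zero f = 1 , answer1 f
radoNumberOf e@(suc _) f with e ≤? f | 2 ∣? e | 3 ∣? e
... | yes e≤f | yes 2∣e | _       = 3 , answer3 (s≤s z≤n) e≤f 2∣e
... | yes e≤f | no 2∤e  | _       = 4 , answer4-balanced (s≤s z≤n) e≤f 2∤e
... | no e≰f  | _       | yes 3∣e = 4 , answer4-unbalanced (s≤s z≤n) (≰⇒> e≰f) 3∣e
... | no e≰f  | _       | no 3∤e  = 5 , answer5 (s≤s z≤n) (≰⇒> e≰f) 3∤e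

excess≤ : ∀ a e → a + 1 + e ≤ 2 * a + 1 → e ≤ a
excess≤ a e = +-cancelˡ-≤ (a + 1) e a ∘ subst (a + 1 + e ≤_) (twice a)
  where
  twice : ∀ a → 2 * a + 1 ≡ a + 1 + a
  twice = solve-∀

parametrise : ∀ {m a} → a + 1 ≤ m → m ≤ 2 * a + 1 →
  Σ ℕ λ e → Σ ℕ λ f → m ≡ suc (e + f + e) × a ≡ e + f
parametrise {m} {a} a+1≤m m≤2a+1 with m≤n⇒∃[o]m+o≡n a+1≤m
... | e , refl with m≤n⇒∃[o]m+o≡n (excess≤ a e m≤2a+1)
...   | f , e+f≡a = e , f , trans (cong (λ a → a + 1 + e) (sym e+f≡a)) (shape e f) , sym e+f≡a
  where
  shape : ∀ e f → e + f + 1 + e ≡ suc (e + f + e)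
  shape = solve-∀

theorem2 : (m a : ℕ) → 1 ≤ a → 1 ≤ m → a + 1 ≤ m → m ≤ 2 * a + 1 →
    Σ ℕ λ R → IsRadoNumber m a R
      × (R ≡ 1 ⇔ m ≡ a + 1)
      × (a + 2 ≤ m →
          (R ≡ 3 ⊎ R ≡ 4 ⊎ R ≡ 5)
          × (R ≡ 3 ⇔ (2 * m ≤ 3 * a + 2 × a % 2 ≡ (m ∸ 1) % 2))
          × (R ≡ 4 ⇔ ((2 * m ≤ 3 * a + 2 × a % 2 ≢ (m ∸ 1) % 2)
                       ⊎ (3 * a + 2 < 2 * m × a % 3 ≡ (m ∸ 1) % 3)))
          × (R ≡ 5 ⇔ (3 * a + 2 < 2 * m × a % 3 ≢ (m ∸ 1) % 3)))
theorem2 m a _ _ a+1≤m m≤2a+1 with parametrise a+1≤m m≤2a+1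
... | e , f , refl , refl = radoNumberOf e f
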